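{- For any measurable spaces $(X,\mathcal X)$ and $(Y,\mathcal Y)$: (i) $\big((X,\mathcal X)\amalg(Y,\mathcal Y)\big)_e\cong(X_e,\mathcal X_e)\otimes(Y_e,\mathcal Y_e)$ as measurable spaces; (ii) $\mathcal T_e=(\{\emptyset\},\{\emptyset,\{\emptyset\}\})$, which is isomorphic to the one-point measurable space $(I,\mathcal I)$, where $\mathcal T=(\emptyset,\{\emptyset\})$.
   Context: $(X,\mathcal X)\amalg(Y,\mathcal Y)$ is the disjoint union $X\uplus Y$ with $\sigma$-field $\{A\uplus B:A\in\mathcal X,B\in\mathcal Y\}$; $\otimes$ is the product measurable space with the $\sigma$-field generated by measurable rectangles. For a set $X$, $X_e$ is the set of finite multisets $x_1\cdots x_n$ over $X$ (the free commutative monoid, with the empty multiset as unit). The $\sigma$-field $\mathcal X_e$ on $X_e$ is generated by the sets $A_1\cdots A_n=\{a_1\cdots a_n:a_i\in A_i\}$, $A_i\in\mathcal X$, $n\ge0$; equivalently it is the smallest $\sigma$-field making all counting functions $n_A(\mathbf x)=$ (number of elements of the multiset $\mathbf x$ lying in $A$), $A\in\mathcal X$, measurable. -}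

module Defs where

open import Data.Nat using (ℕ)
open import Level using (Lift)
open import Data.Empty using (⊥)
open import Data.Unit using (⊤)
open import Data.Product using (Σ; Σ-syntax; _×_; proj₁; proj₂)
open import Data.Sum using (_⊎_; [_,_])
open import Data.List using (List; []; _∷_)
open import Data.List.Relation.Unary.All using (All)
open import Data.List.Relation.Binary.Permutation.Propositional using (_↭_)
open import Function using (_∘_)
open import Function.Bundles using (_⇔_)
open import Relation.Nullary using (¬_)
open import Relation.Binary.PropositionalEquality using (_≡_)

Subset : Set → Set₁
Subset X = X → Set

record MeasSpace : Set₂ where
  field
    Carrier : Set
    Meas    : Subset Carrier → Set₁
open MeasSpace public

record IsSigmaField (X : MeasSpace) : Set₁ where
  field
    ext    : ∀ {A B : Subset (Carrier X)} → Meas X A → (∀ x → A x ⇔ B x) → Meas X B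
    empty  : Meas X (λ _ → ⊥)
    compl  : ∀ {A} → Meas X A → Meas X (λ x → ¬ A x)
    cunion : (A : ℕ → Subset (Carrier X)) → (∀ n → Meas X (A n))
           → Meas X (λ x → Σ[ n ∈ ℕ ] A n x)

-- Measurable spaces whose carrier is a setoid (needed for multisets, which are
-- lists up to permutation, since Agda has no quotient types).
record SMeasSpace : Set₂ where
  field
    SCarrier : Set
    _≈_      : SCarrier → SCarrier → Set
    SMeas    : Subset SCarrier → Set₁
open SMeasSpace public

toS : MeasSpace → SMeasSpace
toS X = record { SCarrier = Carrier X ; _≈_ = _≡_ ; SMeas = Meas X }

data Gen {X : Set} (G : Subset X → Set₁) : Subset X → Set₁ where
  gen    : ∀ {A} → G A → Gen G A
  ext    : ∀ {A B} → Gen G A → (∀ x → A x ⇔ B x) → Gen G B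
  empty  : Gen G (λ _ → ⊥)
  compl  : ∀ {A} → Gen G A → Gen G (λ x → ¬ A x)
  cunion : (A : ℕ → Subset X) → (∀ n → Gen G (A n)) → Gen G (λ x → Σ[ n ∈ ℕ ] A n x)

_∐_ : MeasSpace → MeasSpace → MeasSpace
X ∐ Y = record
  { Carrier = Carrier X ⊎ Carrier Y
  ; Meas = λ C → Σ[ A ∈ Subset (Carrier X) ] Σ[ B ∈ Subset (Carrier Y) ]
                   (Meas X A × Meas Y B × (∀ z → C z ⇔ [ A , B ] z))
  }

Fits : {X : Set} → List X → List (Subset X) → Set
Fits []       []       = ⊤
Fits []       (_ ∷ _)  = ⊥
Fits (_ ∷ _)  []       = ⊥
Fits (a ∷ as) (A ∷ As) = A a × Fits as As

-- Generators A₁⋯Aₙ = { a₁⋯aₙ : aᵢ ∈ Aᵢ } of 𝒳ₑ (multisets = lists up to ↭).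
data MGen (X : MeasSpace) : Subset (List (Carrier X)) → Set₁ where
  mgen : (As : List (Subset (Carrier X))) → All (Meas X) As →
         MGen X (λ l → Σ[ as ∈ List (Carrier X) ]
                         ((l ↭ as) × Fits as As))

_ₑ : MeasSpace → SMeasSpace
X ₑ = record { SCarrier = List (Carrier X) ; _≈_ = _↭_ ; SMeas = Gen (MGen X) }

data Rect (S T : SMeasSpace) : Subset (SCarrier S × SCarrier T) → Set₁ where
  rect : ∀ {A B} → SMeas S A → SMeas T B → Rect S T (λ p → A (proj₁ p) × B (proj₂ p))

_⊗_ : SMeasSpace → SMeasSpace → SMeasSpace
S ⊗ T = record
  { SCarrier = SCarrier S × SCarrier T
  ; _≈_ = λ p q → _≈_ S (proj₁ p) (proj₁ q) × _≈_ T (proj₂ p) (proj₂ q)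
  ; SMeas = Gen (Rect S T)
  }

record _≅_ (S T : SMeasSpace) : Set₂ where
  field
    to       : SCarrier S → SCarrier T
    from     : SCarrier T → SCarrier S
    to-resp  : ∀ {x y} → _≈_ S x y → _≈_ T (to x) (to y)
    from-resp : ∀ {x y} → _≈_ T x y → _≈_ S (from x) (from y)
    to-meas  : ∀ B → SMeas T B → SMeas S (B ∘ to)
    from-meas : ∀ A → SMeas S A → SMeas T (A ∘ from)
    from-to  : ∀ x → _≈_ S (from (to x)) x
    to-from  : ∀ y → _≈_ T (to (from y)) y

𝒯 : MeasSpace
𝒯 = record { Carrier = ⊥ ; Meas = λ C → Lift _ (∀ z → C z ⇔ ⊥) }

𝐈 : MeasSpace
𝐈 = record { Carrier = ⊤ ; Meas = λ C → Lift _ ((∀ z → C z ⇔ ⊥) ⊎ (∀ z → C z ⇔ ⊤)) }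

-- Excluded middle (the paper's ambient classical mathematics).
LEM : Set₁
LEM = (P : Set) → P ⊎ ¬ P

-- A finite multiset over X ⊎ Y is the same thing as a pair of finite multisets, one
-- over X and one over Y: split off the left and the right elements, and conversely
-- join the two lists. The left part of l lies in A₁⋯Aₙ iff,
-- for some m, l lies in (A₁ ⊎ ∅)⋯(Aₙ ⊎ ∅)(∅ ⊎ Y)ᵐ; the right part is the left part
-- after swapping the summands. Conversely, if Cᵢ = Aᵢ ⊎ Bᵢ, the join of (x, y) lies
-- in C₁⋯Cₙ iff for one of the 2ⁿ ways of sending each index i to a side, x lies in
-- the product of the chosen Aᵢ and y in the product of the remaining Bᵢ: a finite
-- union of rectangles. For the empty space, the only multiset is the empty one.
-- Excluded middle is needed to obtain intersections from complements and unions,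
-- and to split every subset of the one-point space into ∅ or everything.
module Submission where

open import Defs
open import Level using (lift)
open import Data.Nat using (ℕ; zero; suc)
open import Data.Empty using (⊥; ⊥-elim)
open import Data.Unit using (⊤; tt)
open import Data.Product using (_×_; _,_; proj₁; proj₂; Σ-syntax; uncurry)
import Data.Product as Product
open import Data.Sum using (_⊎_; inj₁; inj₂; [_,_]; isInj₁; isInj₂) renaming (swap to ⊎-swap)
open import Data.List using (List; []; _∷_; _++_; map; replicate; length; mapMaybe)
open import Data.List.Relation.Unary.All using (All; []; _∷_)
import Data.List.Relation.Unary.All as All
import Data.List.Relation.Unary.All.Properties as Allₚ
open import Data.List.Relation.Unary.Any using (Any; toSum; fromSum; satisfied)
open import Data.Bool using (Bool; true; false)
open import Data.Vec using (Vec; []; _∷_)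
open import Data.List.Membership.Propositional using (_∈_; lose)
open import Data.List.Membership.Propositional.Properties
  using (∈-map⁺; ∈-++⁺ˡ; ∈-++⁺ʳ)
open import Data.List.Relation.Binary.Permutation.Propositional
open import Data.List.Relation.Binary.Permutation.Propositional.Properties
  using (shift; ++⁺; map⁺; ↭-map-inv; mapMaybe-↭)
open import Function using (_∘_; id; const)
open import Function.Bundles using (_⇔_; mk⇔; Equivalence)
open import Function.Construct.Composition using (_⇔-∘_)
open import Function.Construct.Symmetry using (⇔-sym)
open import Relation.Nullary using (¬_)
open import Relation.Binary.PropositionalEquality using (_≡_; cong; subst; sym)
  renaming (refl to ≡-refl)

open Equivalence using () renaming (to to ⇒; from to ⇐)

module _ {S : Set} {H : Subset S → Set₁} where

  Gen-∪ : ∀ {A B} → Gen H A → Gen H B → Gen H (λ x → A x ⊎ B x)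
  Gen-∪ {A} {B} a b = ext (cunion F F-meas)
      (λ x → mk⇔ (λ { (zero , p) → inj₁ p ; (suc _ , p) → inj₂ p })
                 [ (λ p → zero , p) , (λ p → suc zero , p) ])
    where
    F : ℕ → Subset S
    F zero    = A
    F (suc _) = B
    F-meas : ∀ n → Gen H (F n)
    F-meas zero    = a
    F-meas (suc _) = b

  Gen-∩ : LEM → ∀ {A B} → Gen H A → Gen H B → Gen H (λ x → A x × B x)
  Gen-∩ lem {A} {B} a b = ext (compl (Gen-∪ (compl a) (compl b)))
      (λ x → mk⇔ (de-Morgan x) (λ (p , q) → [ (λ ¬p → ¬p p) , (λ ¬q → ¬q q) ]))
    where
    de-Morgan : ∀ x → ¬ (¬ A x ⊎ ¬ B x) → A x × B x
    de-Morgan x h with lem (A x) | lem (B x)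
    ... | inj₁ p  | inj₁ q  = p , q
    ... | inj₂ ¬p | _       = ⊥-elim (h (inj₁ ¬p))
    ... | _       | inj₂ ¬q = ⊥-elim (h (inj₂ ¬q))

  Gen-Any : {R : Set} (F : R → Subset S) → (∀ r → Gen H (F r)) →
            ∀ rs → Gen H (λ x → Any (λ r → F r x) rs)
  Gen-Any F F-meas []       = ext empty (λ _ → mk⇔ ⊥-elim (λ ()))
  Gen-Any F F-meas (r ∷ rs) =
    ext (Gen-∪ (F-meas r) (Gen-Any F F-meas rs)) (λ _ → mk⇔ fromSum toSum)

Gen-preimage : {S T : Set} {G : Subset T → Set₁} {H : Subset S → Set₁} (f : S → T) →
               (∀ {A} → G A → Gen H (A ∘ f)) → ∀ {A} → Gen G A → Gen H (A ∘ f)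
Gen-preimage f g-pre (gen g)      = g-pre g
Gen-preimage f g-pre (ext g e)    = ext (Gen-preimage f g-pre g) (e ∘ f)
Gen-preimage f g-pre empty        = empty
Gen-preimage f g-pre (compl g)    = compl (Gen-preimage f g-pre g)
Gen-preimage f g-pre (cunion A g) = cunion (λ n → A n ∘ f) (λ n → Gen-preimage f g-pre (g n))

full-meas : {X : MeasSpace} → IsSigmaField X → Meas X (λ _ → ⊤)
full-meas σ = IsSigmaField.ext σ (IsSigmaField.compl σ (IsSigmaField.empty σ))
                               (λ _ → mk⇔ (λ _ → tt) (λ _ ()))

allVecs : ∀ n → List (Vec Bool n)
allVecs zero    = [] ∷ []
allVecs (suc n) = map (true ∷_) (allVecs n) ++ map (false ∷_) (allVecs n)

∈-allVecs : ∀ {n} (s : Vec Bool n) → s ∈ allVecs n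
∈-allVecs         []          = Any.here ≡-refl
∈-allVecs         (true ∷ s)  = ∈-++⁺ˡ (∈-map⁺ (true ∷_) (∈-allVecs s))
∈-allVecs {suc n} (false ∷ s) =
  ∈-++⁺ʳ (map (true ∷_) (allVecs n)) (∈-map⁺ (false ∷_) (∈-allVecs s))

-- ⟦ A₁ ∷ ⋯ ∷ Aₙ ⟧ is the paper's A₁⋯Aₙ; mgen As _ has type MGen X ⟦ As ⟧.
⟦_⟧ : {Z : Set} → List (Subset Z) → Subset (List Z)
⟦_⟧ {Z} As l = Σ[ as ∈ List Z ] ((l ↭ as) × Fits as As)

module _ {Z : Set} where

  Fits-++ : ∀ {as bs : List Z} {As Bs} → Fits as As → Fits bs Bs → Fits (as ++ bs) (As ++ Bs)
  Fits-++ {[]}    {As = []}    _       q = q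
  Fits-++ {[]}    {As = _ ∷ _} ()
  Fits-++ {_ ∷ _} {As = []}    ()
  Fits-++ {_ ∷ _} {As = _ ∷ _} (p , f) q = p , Fits-++ f q

  Fits-replicate : {P : Subset Z} {zs : List Z} → All P zs → Fits zs (replicate (length zs) P)
  Fits-replicate []       = tt
  Fits-replicate (p ∷ ps) = p , Fits-replicate ps

  ⟦⟧-resp : {As Bs : List (Subset Z)} → (∀ cs → Fits cs As ⇔ Fits cs Bs) →
            ∀ l → ⟦ As ⟧ l ⇔ ⟦ Bs ⟧ l
  ⟦⟧-resp e l = mk⇔ (Product.map₂ (Product.map₂ (⇒ (e _))))
                    (Product.map₂ (Product.map₂ (⇐ (e _))))

  module _ {W : Set} (f : Z → W) where

    Fits-map⁺ : {F : Subset Z → Subset W} → (∀ {A z} → A z → F A (f z)) →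
                ∀ {zs As} → Fits zs As → Fits (map f zs) (map F As)
    Fits-map⁺ F⁺ {[]}    {[]}    _       = tt
    Fits-map⁺ F⁺ {_ ∷ _} {_ ∷ _} (p , q) = F⁺ p , Fits-map⁺ F⁺ q

    Fits-map : ∀ {zs As} → Fits (map f zs) As ⇔ Fits zs (map (_∘ f) As)
    Fits-map {[]}    {[]}    = mk⇔ id id
    Fits-map {[]}    {_ ∷ _} = mk⇔ id id
    Fits-map {_ ∷ _} {[]}    = mk⇔ id id
    Fits-map {_ ∷ _} {_ ∷ _} = mk⇔ (Product.map₂ (⇒ Fits-map)) (Product.map₂ (⇐ Fits-map))

map-measurable : {Z W : MeasSpace} (f : Carrier Z → Carrier W) →
                 (∀ {A} → Meas W A → Meas Z (A ∘ f)) →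
                 ∀ {A} → Gen (MGen W) A → Gen (MGen Z) (A ∘ map f)
map-measurable {Z} {W} f f-meas = Gen-preimage (map f) generator
  where
  map-⟦⟧ : ∀ As l → ⟦ As ⟧ (map f l) → ⟦ map (_∘ f) As ⟧ l
  map-⟦⟧ As l (bs , p , q) with cs , ≡-refl , p′ ← ↭-map-inv f p = cs , p′ , ⇒ (Fits-map f) q

  generator : ∀ {A} → MGen W A → Gen (MGen Z) (A ∘ map f)
  generator (mgen As ms) =
    ext (gen (mgen (map (_∘ f) As) (Allₚ.map⁺ (All.map f-meas ms))))
        (λ l → mk⇔ (λ (cs , p , q) → map f cs , map⁺ f p , ⇐ (Fits-map f) q) (map-⟦⟧ As l))

module _ {X Y : Set} where

  lefts : List (X ⊎ Y) → List X
  lefts = mapMaybe isInj₁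

  rights : List (X ⊎ Y) → List Y
  rights = mapMaybe isInj₂

  join : List X × List Y → List (X ⊎ Y)
  join (xs , ys) = map inj₁ xs ++ map inj₂ ys

  lefts-join : ∀ xs ys → lefts (join (xs , ys)) ≡ xs
  lefts-join (x ∷ xs) ys       = cong (x ∷_) (lefts-join xs ys)
  lefts-join []       []       = ≡-refl
  lefts-join []       (y ∷ ys) = lefts-join [] ys

  rights-join : ∀ xs ys → rights (join (xs , ys)) ≡ ys
  rights-join (x ∷ xs) ys       = rights-join xs ys
  rights-join []       []       = ≡-refl
  rights-join []       (y ∷ ys) = cong (y ∷_) (rights-join [] ys)

  ↭-join-lefts-rights : ∀ l → l ↭ join (lefts l , rights l)
  ↭-join-lefts-rights []           = refl
  ↭-join-lefts-rights (inj₁ x ∷ l) = prep (inj₁ x) (↭-join-lefts-rights l)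
  ↭-join-lefts-rights (inj₂ y ∷ l) =
    trans (prep (inj₂ y) (↭-join-lefts-rights l))
          (↭-sym (shift (inj₂ y) (map inj₁ (lefts l)) (map inj₂ (rights l))))

  ι₁ : Subset X → Subset (X ⊎ Y)
  ι₁ A = [ A , const ⊥ ]

  ι₂ : Subset Y → Subset (X ⊎ Y)
  ι₂ B = [ const ⊥ , B ]

  Fits-lefts : ∀ cs As m → Fits cs (map ι₁ As ++ replicate m (ι₂ (const ⊤))) →
               Fits (lefts cs) As
  Fits-lefts []           []       zero    _       = tt
  Fits-lefts (inj₂ y ∷ cs) []      (suc m) (_ , f) = Fits-lefts cs [] m f
  Fits-lefts (inj₁ x ∷ cs) []      (suc m) (() , _)
  Fits-lefts (inj₁ x ∷ cs) (A ∷ As) m      (p , f) = p , Fits-lefts cs As m f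

  lefts-⟦⟧ : ∀ As l →
    ⟦ As ⟧ (lefts l) ⇔ (Σ[ m ∈ ℕ ] ⟦ map ι₁ As ++ replicate m (ι₂ (const ⊤)) ⟧ l)
  lefts-⟦⟧ As l = mk⇔
    (λ (as , p , f) →
       length (map inj₂ (rights l)) , join (as , rights l)
       , trans (↭-join-lefts-rights l) (++⁺ (map⁺ inj₁ p) refl)
       , Fits-++ (Fits-map⁺ inj₁ id f)
                 (Fits-replicate (Allₚ.map⁺ (All.universal (λ _ → tt) (rights l)))))
    (λ (m , cs , p , f) → lefts cs , mapMaybe-↭ isInj₁ p , Fits-lefts cs As m f)

  -- A vector s of sides sends the i-th pair (Aᵢ , Bᵢ) to the X side when s i = true.
  select : (ps : List (Subset X × Subset Y)) → Vec Bool (length ps) →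
           List (Subset X) × List (Subset Y)
  select []             []          = [] , []
  select ((A , B) ∷ ps) (true ∷ s)  = Product.map₁ (A ∷_) (select ps s)
  select ((A , B) ∷ ps) (false ∷ s) = Product.map₂ (B ∷_) (select ps s)

  Fits-select : ∀ ps cs → Fits cs (map (uncurry [_,_]) ps) →
    Σ[ s ∈ Vec Bool (length ps) ]
      (Fits (lefts cs) (proj₁ (select ps s)) × Fits (rights cs) (proj₂ (select ps s)))
  Fits-select []       []            _       = [] , tt , tt
  Fits-select (_ ∷ ps) (inj₁ x ∷ cs) (a , f) with s , fl , fr ← Fits-select ps cs f =
    true ∷ s , (a , fl) , fr
  Fits-select (_ ∷ ps) (inj₂ y ∷ cs) (b , f) with s , fl , fr ← Fits-select ps cs f =
    false ∷ s , fl , (b , fr)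

  select-Fits : ∀ ps s as bs → Fits as (proj₁ (select ps s)) → Fits bs (proj₂ (select ps s)) →
    Σ[ cs ∈ List (X ⊎ Y) ] ((join (as , bs) ↭ cs) × Fits cs (map (uncurry [_,_]) ps))
  select-Fits [] [] []      []      _ _ = [] , refl , tt
  select-Fits [] [] (_ ∷ _) _       () _
  select-Fits [] [] []      (_ ∷ _) _ ()
  select-Fits (_ ∷ ps) (true ∷ s)  []       bs () _
  select-Fits (_ ∷ ps) (true ∷ s)  (a ∷ as) bs (pa , fa) fb
    with cs , p , f ← select-Fits ps s as bs fa fb =
    inj₁ a ∷ cs , prep (inj₁ a) p , pa , f
  select-Fits (_ ∷ ps) (false ∷ s) as []       _ ()
  select-Fits (_ ∷ ps) (false ∷ s) as (b ∷ bs) fa (pb , fb)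
    with cs , p , f ← select-Fits ps s as bs fa fb =
    inj₂ b ∷ cs , trans (shift (inj₂ b) (map inj₁ as) (map inj₂ bs)) (prep (inj₂ b) p)
    , pb , f

  ⟦_⟧² : List (Subset X) × List (Subset Y) → Subset (List X × List Y)
  ⟦ As , Bs ⟧² (xs , ys) = ⟦ As ⟧ xs × ⟦ Bs ⟧ ys

  join-⟦⟧ : ∀ ps xys → ⟦ map (uncurry [_,_]) ps ⟧ (join xys) ⇔
                       Any (λ s → ⟦ select ps s ⟧² xys) (allVecs (length ps))
  join-⟦⟧ ps (xs , ys) = mk⇔ to from
    where
    Selected : Set
    Selected = Any (λ s → ⟦ select ps s ⟧² (xs , ys)) (allVecs (length ps))

    to : ⟦ map (uncurry [_,_]) ps ⟧ (join (xs , ys)) → Selected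
    to (cs , p , f) with s , fl , fr ← Fits-select ps cs f =
      lose (∈-allVecs s)
        ( (lefts cs , subst (_↭ lefts cs) (lefts-join xs ys) (mapMaybe-↭ isInj₁ p) , fl)
        , (rights cs , subst (_↭ rights cs) (rights-join xs ys) (mapMaybe-↭ isInj₂ p) , fr))
    from : Selected → ⟦ map (uncurry [_,_]) ps ⟧ (join (xs , ys))
    from u with s , (as , p , fa) , (bs , q , fb) ← satisfied u
           with cs , r , f ← select-Fits ps s as bs fa fb =
      cs , trans (++⁺ (map⁺ inj₁ p) (map⁺ inj₂ q)) r , f

rights≡lefts∘swap : {X Y : Set} (l : List (X ⊎ Y)) → rights l ≡ lefts (map ⊎-swap l)
rights≡lefts∘swap []           = ≡-refl
rights≡lefts∘swap (inj₁ x ∷ l) = rights≡lefts∘swap l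
rights≡lefts∘swap (inj₂ y ∷ l) = cong (y ∷_) (rights≡lefts∘swap l)

module _ (X Y : MeasSpace) (σX : IsSigmaField X) (σY : IsSigmaField Y) where

  ι₁-meas : ∀ {A} → Meas X A → Meas (X ∐ Y) (ι₁ A)
  ι₁-meas {A} m = A , const ⊥ , m , IsSigmaField.empty σY , (λ _ → mk⇔ id id)

  ι₂-full-meas : Meas (X ∐ Y) (ι₂ (const ⊤))
  ι₂-full-meas = const ⊥ , const ⊤ , IsSigmaField.empty σX , full-meas σY , (λ _ → mk⇔ id id)

  lefts-measurable : ∀ {A} → Gen (MGen X) A → Gen (MGen (X ∐ Y)) (A ∘ lefts)
  lefts-measurable = Gen-preimage lefts generator
    where
    generator : ∀ {A} → MGen X A → Gen (MGen (X ∐ Y)) (A ∘ lefts)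
    generator (mgen As ms) =
      ext (cunion (λ m → ⟦ map ι₁ As ++ replicate m (ι₂ (const ⊤)) ⟧)
                  (λ m → gen (mgen _ (Allₚ.++⁺ (Allₚ.map⁺ (All.map ι₁-meas ms))
                                               (Allₚ.replicate⁺ m ι₂-full-meas)))))
          (λ l → ⇔-sym (lefts-⟦⟧ As l))

swap-meas : {X Y : MeasSpace} → ∀ {C} → Meas (Y ∐ X) C → Meas (X ∐ Y) (C ∘ ⊎-swap)
swap-meas (A , B , mA , mB , e) =
  B , A , mB , mA , λ { (inj₁ x) → e (inj₂ x) ; (inj₂ y) → e (inj₁ y) }

rights-measurable : (X Y : MeasSpace) → IsSigmaField X → IsSigmaField Y →
                    ∀ {B} → Gen (MGen Y) B → Gen (MGen (X ∐ Y)) (B ∘ rights)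
rights-measurable X Y σX σY {B} b =
  ext (map-measurable ⊎-swap (swap-meas {X} {Y}) (lefts-measurable Y X σY σX b))
      (λ l → mk⇔ (subst B (sym (rights≡lefts∘swap l))) (subst B (rights≡lefts∘swap l)))

∐-sides : {X Y : MeasSpace} {Cs : List (Subset (Carrier X ⊎ Carrier Y))} →
  All (Meas (X ∐ Y)) Cs →
  Σ[ ps ∈ List (Subset (Carrier X) × Subset (Carrier Y)) ]
    (All (λ p → Meas X (proj₁ p) × Meas Y (proj₂ p)) ps
     × (∀ cs → Fits cs Cs ⇔ Fits cs (map (uncurry [_,_]) ps)))
∐-sides []                          = [] , [] , λ _ → mk⇔ id id
∐-sides ((A , B , mA , mB , e) ∷ ms) with ps , mps , Fits⇔ ← ∐-sides ms =
  (A , B) ∷ ps , (mA , mB) ∷ mps ,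
  λ { [] → mk⇔ id id
    ; (c ∷ cs) → mk⇔ (Product.map (⇒ (e c)) (⇒ (Fits⇔ cs)))
                     (Product.map (⇐ (e c)) (⇐ (Fits⇔ cs))) }

select-meas : {X Y : MeasSpace} (ps : List (Subset (Carrier X) × Subset (Carrier Y))) →
  All (λ p → Meas X (proj₁ p) × Meas Y (proj₂ p)) ps →
  ∀ s → All (Meas X) (proj₁ (select ps s)) × All (Meas Y) (proj₂ (select ps s))
select-meas []       []              []          = [] , []
select-meas (_ ∷ ps) ((mA , _) ∷ ms) (true ∷ s)  = Product.map₁ (mA ∷_) (select-meas ps ms s)
select-meas (_ ∷ ps) ((_ , mB) ∷ ms) (false ∷ s) = Product.map₂ (mB ∷_) (select-meas ps ms s)

join-measurable : {X Y : MeasSpace} →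
                  ∀ {C} → Gen (MGen (X ∐ Y)) C → Gen (Rect (X ₑ) (Y ₑ)) (C ∘ join)
join-measurable {X} {Y} = Gen-preimage join generator
  where
  generator : ∀ {C} → MGen (X ∐ Y) C → Gen (Rect (X ₑ) (Y ₑ)) (C ∘ join)
  generator (mgen Cs ms) with ps , mps , Fits⇔ ← ∐-sides ms =
    ext (Gen-Any (λ s → ⟦ select ps s ⟧²) rectangle (allVecs (length ps)))
        (λ xys → ⟦⟧-resp (⇔-sym ∘ Fits⇔) (join xys) ⇔-∘ ⇔-sym (join-⟦⟧ ps xys))
    where
    rectangle : ∀ s → Gen (Rect (X ₑ) (Y ₑ)) ⟦ select ps s ⟧²
    rectangle s with mAs , mBs ← select-meas ps mps s =
      gen (rect (gen (mgen _ mAs)) (gen (mgen _ mBs)))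

∐ₑ≅ₑ⊗ₑ : LEM → {X Y : MeasSpace} → IsSigmaField X → IsSigmaField Y →
         ((X ∐ Y) ₑ) ≅ ((X ₑ) ⊗ (Y ₑ))
∐ₑ≅ₑ⊗ₑ lem {X} {Y} σX σY = record
  { to        = λ l → lefts l , rights l
  ; from      = join
  ; to-resp   = λ p → mapMaybe-↭ isInj₁ p , mapMaybe-↭ isInj₂ p
  ; from-resp = λ (p , q) → ++⁺ (map⁺ inj₁ p) (map⁺ inj₂ q)
  ; to-meas   = λ _ → Gen-preimage (λ l → lefts l , rights l) λ { (rect a b) →
                  Gen-∩ lem (lefts-measurable X Y σX σY a) (rights-measurable X Y σX σY b) }
  ; from-meas = λ _ → join-measurable
  ; from-to   = ↭-sym ∘ ↭-join-lefts-rights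
  ; to-from   = λ (xs , ys) → ↭-reflexive (lefts-join xs ys) , ↭-reflexive (rights-join xs ys)
  }

Trivial : {A : Set} → Subset A → Set
Trivial C = (∀ a → C a ⇔ ⊥) ⊎ (∀ a → C a ⇔ ⊤)

Trivial-∘ : {A B : Set} {C : Subset B} (f : A → B) → Trivial C → Trivial (C ∘ f)
Trivial-∘ f (inj₁ e) = inj₁ (e ∘ f)
Trivial-∘ f (inj₂ e) = inj₂ (e ∘ f)

List⊥-↭-[] : (l : List ⊥) → l ↭ []
List⊥-↭-[] [] = refl

List⊥-Trivial : LEM → (C : Subset (List ⊥)) → Trivial C
List⊥-Trivial lem C with lem (C [])
... | inj₁ c  = inj₂ λ { [] → mk⇔ (const tt) (const c) }
... | inj₂ ¬c = inj₁ λ { [] → mk⇔ ¬c ⊥-elim }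

Trivial⇒𝒯ₑ-meas : {C : Subset (List ⊥)} → Trivial C → SMeas (𝒯 ₑ) C
Trivial⇒𝒯ₑ-meas (inj₁ e) = ext empty (λ l → ⇔-sym (e l))
Trivial⇒𝒯ₑ-meas (inj₂ e) = ext (compl empty) (λ l → mk⇔ (λ _ → ⇐ (e l) tt) (λ _ ()))

𝒯ₑ≅𝐈 : LEM → (𝒯 ₑ) ≅ toS 𝐈
𝒯ₑ≅𝐈 lem = record
  { to        = const tt
  ; from      = const []
  ; to-resp   = const ≡-refl
  ; from-resp = const refl
  ; to-meas   = λ _ (lift B-trivial) → Trivial⇒𝒯ₑ-meas (Trivial-∘ (const tt) B-trivial)
  ; from-meas = λ A _ → lift (Trivial-∘ (const []) (List⊥-Trivial lem A))
  ; from-to   = ↭-sym ∘ List⊥-↭-[]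
  ; to-from   = λ _ → ≡-refl
  }

proposition3p7 : LEM →
    ((X Y : MeasSpace) → IsSigmaField X → IsSigmaField Y →
       ((X ∐ Y) ₑ) ≅ ((X ₑ) ⊗ (Y ₑ)))
    ×
    (((l : List ⊥) → l ↭ [])
      × ((C : Subset (List ⊥)) → SMeas (𝒯 ₑ) C → ((∀ l → C l ⇔ ⊥) ⊎ (∀ l → C l ⇔ ⊤)))
      × ((C : Subset (List ⊥)) → ((∀ l → C l ⇔ ⊥) ⊎ (∀ l → C l ⇔ ⊤)) → SMeas (𝒯 ₑ) C)
      × ((𝒯 ₑ) ≅ toS 𝐈))
proposition3p7 lem =
  (λ X Y → ∐ₑ≅ₑ⊗ₑ lem) ,
  List⊥-↭-[] ,
  (λ C _ → List⊥-Trivial lem C) ,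
  (λ C → Trivial⇒𝒯ₑ-meas) ,
  𝒯ₑ≅𝐈 lem
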